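{- If $D$ is a point-determining digraph with at least one vertex, then there exists a vertex $v\in V(D)$ such that $D-v$ is point-determining.
   Context: Digraphs are finite, without loops and multiple arcs. For distinct vertices $u,v,w$ of a digraph $D$, $w$ distinguishes $u,v$ if exactly one of $u,v$ is an in-neighbour of $w$, or exactly one of $u,v$ is an out-neighbour of $w$. Distinct vertices $u,v$ are twins in $D$ if no vertex of $D$ distinguishes them; they are false twins if moreover neither $(u,v)$ nor $(v,u)$ is an arc. $D$ is point-determining if it contains no pair of false twins. -}

module Defs where

open import Data.Nat using (ℕ; suc)
open import Data.Fin using (Fin; punchIn)
open import Data.Bool using (Bool; true; false)
open import Data.Product using (_×_; Σ)
open import Data.Sum using (_⊎_)
open import Relation.Binary.PropositionalEquality using (_≡_; _≢_)
open import Relation.Nullary using (¬_)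

record Digraph (n : ℕ) : Set where
  field
    adj      : Fin n → Fin n → Bool
    loopless : ∀ v → adj v v ≡ false
open Digraph public

Distinguishes : ∀ {n} → Digraph n → Fin n → Fin n → Fin n → Set
Distinguishes D w u v = (adj D u w ≢ adj D v w) ⊎ (adj D w u ≢ adj D w v)

Twins : ∀ {n} → Digraph n → Fin n → Fin n → Set
Twins D u v = u ≢ v × (∀ w → w ≢ u → w ≢ v → ¬ Distinguishes D w u v)

FalseTwins : ∀ {n} → Digraph n → Fin n → Fin n → Set
FalseTwins D u v = Twins D u v × adj D u v ≡ false × adj D v u ≡ false

PointDetermining : ∀ {n} → Digraph n → Set
PointDetermining D = ∀ u v → ¬ FalseTwins D u v

delete : ∀ {n} → Digraph (suc n) → Fin (suc n) → Digraph n
delete D v = record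
  { adj      = λ x y → adj D (punchIn v x) (punchIn v y)
  ; loopless = λ x → loopless D (punchIn v x)
  }

-- Suppose every D - v has a pair of false twins {p v, q v}.  These are exactly
-- the vertices that only v distinguishes, and point-determinacy of D forces
-- the relation "y ∈ {p x, q x}" to be symmetric: it is a 2-regular graph on
-- V(D).  Fix a vertex w and colour each y by whether (y , w) is an arc (or
-- (w , y), depending on how w separates p w from q w).  Every x ≠ w sees two
-- neighbours of the same colour, w sees two of different colours; counting
-- coloured neighbours over all vertices is then odd, yet by double counting it
-- is twice the number of coloured vertices.
module Submission where

open import Defs
open import Data.Nat using (ℕ; suc; _+_; _*_)
open import Data.Nat.Properties
  using (+-*-semiring; +-comm; *-identityˡ; *-identityʳ; +-identityʳ; *-distribʳ-+; even≢odd)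
open import Data.Fin using (Fin; zero; punchIn; punchOut)
open import Data.Fin.Properties using (_≟_; any?; all?; ¬∀⟶∃¬; punchInᵢ≢i; punchIn-injective; punchIn-punchOut)
open import Data.Bool using (Bool; true; false; _∧_; _xor_)
open import Data.Bool.Properties using (xor-same) renaming (_≟_ to _≟ᵇ_)
open import Data.Product using (Σ; ∃₂; _×_; _,_; proj₁; proj₂)
open import Data.Sum as Sum using (_⊎_; inj₁; inj₂)
open import Function using (_∘_)
open import Relation.Binary.PropositionalEquality
open import Relation.Nullary using (Dec; yes; no; ¬_; does; contradiction)
open import Relation.Nullary.Decidable using (¬?; _×-dec_; _⊎-dec_; _→-dec_; decidable-stable; dec-true; dec-false)
open import Algebra.Properties.Semiring.Sum +-*-semiring
  using (sum-syntax; sum-remove; sum-cong-≗; sum-replicate-zero; ∑-distrib-+; ∑-comm; *-distribˡ-sum; *-distribʳ-sum)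

bit : Bool → ℕ
bit true  = 1
bit false = 0

bit-+ : ∀ a b → bit a + bit b ≡ 2 * bit (a ∧ b) + bit (a xor b)
bit-+ true  true  = refl
bit-+ true  false = refl
bit-+ false true  = refl
bit-+ false false = refl

xor-≢ : ∀ {a b} → a ≢ b → a xor b ≡ true
xor-≢ {true}  {true}  a≢b = contradiction refl a≢b
xor-≢ {true}  {false} _   = refl
xor-≢ {false} {true}  _   = refl
xor-≢ {false} {false} a≢b = contradiction refl a≢b

δ : ∀ {n} → Fin n → Fin n → ℕ
δ a y = bit (does (a ≟ y))

δ-refl : ∀ {n} (a : Fin n) → δ a a ≡ 1
δ-refl a = cong bit (dec-true (a ≟ a) refl)

δ-≢ : ∀ {n} {a y : Fin n} → a ≢ y → δ a y ≡ 0
δ-≢ {a = a} {y} a≢y = cong bit (dec-false (a ≟ y) a≢y)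

∑-δ : ∀ {n} (a : Fin n) (f : Fin n → ℕ) → ∑[ y < n ] (δ a y * f y) ≡ f a
∑-δ {suc n} a f = begin
  ∑[ y < suc n ] (δ a y * f y)
    ≡⟨ sum-remove {i = a} (λ y → δ a y * f y) ⟩
  δ a a * f a + ∑[ j < n ] (δ a (punchIn a j) * f (punchIn a j))
    ≡⟨ cong₂ _+_ (cong (_* f a) (δ-refl a)) (sum-cong-≗ λ j → cong (_* f (punchIn a j)) (δ-≢ (punchInᵢ≢i a j ∘ sym))) ⟩
  1 * f a + ∑[ j < n ] 0
    ≡⟨ cong₂ _+_ (*-identityˡ (f a)) (sum-replicate-zero n) ⟩
  f a + 0
    ≡⟨ +-identityʳ (f a) ⟩
  f a ∎
  where open ≡-Reasoning

∑-δ-const : ∀ {n} (a : Fin n) → ∑[ y < n ] δ a y ≡ 1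
∑-δ-const a = trans (sum-cong-≗ λ y → sym (*-identityʳ (δ a y))) (∑-δ a (λ _ → 1))

module TwoRegular {n : ℕ} (p q : Fin n → Fin n) (p≢q : ∀ x → p x ≢ q x)
  (symmetric : ∀ {x y} → p x ≡ y ⊎ q x ≡ y → p y ≡ x ⊎ q y ≡ x) where

  adjacency : Fin n → Fin n → ℕ
  adjacency x y = δ (p x) y + δ (q x) y

  adjacency-adjacent : ∀ {x y} → p x ≡ y ⊎ q x ≡ y → adjacency x y ≡ 1
  adjacency-adjacent {x} (inj₁ refl) = cong₂ _+_ (δ-refl (p x)) (δ-≢ (p≢q x ∘ sym))
  adjacency-adjacent {x} (inj₂ refl) = cong₂ _+_ (δ-≢ (p≢q x)) (δ-refl (q x))

  adjacency-nonadjacent : ∀ {x y} → ¬ (p x ≡ y ⊎ q x ≡ y) → adjacency x y ≡ 0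
  adjacency-nonadjacent ¬adj = cong₂ _+_ (δ-≢ (¬adj ∘ inj₁)) (δ-≢ (¬adj ∘ inj₂))

  adjacency-sym : ∀ x y → adjacency x y ≡ adjacency y x
  adjacency-sym x y with (p x ≟ y ⊎-dec q x ≟ y) | (p y ≟ x ⊎-dec q y ≟ x)
  ... | yes xy | yes yx = trans (adjacency-adjacent xy) (sym (adjacency-adjacent yx))
  ... | yes xy | no ¬yx = contradiction (symmetric xy) ¬yx
  ... | no ¬xy | yes yx = contradiction (symmetric yx) ¬xy
  ... | no ¬xy | no ¬yx = trans (adjacency-nonadjacent ¬xy) (sym (adjacency-nonadjacent ¬yx))

  ∑-adjacency : ∀ x (f : Fin n → ℕ) → ∑[ y < n ] (adjacency x y * f y) ≡ f (p x) + f (q x)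
  ∑-adjacency x f = begin
    ∑[ y < n ] (adjacency x y * f y)
      ≡⟨ sum-cong-≗ (λ y → *-distribʳ-+ (f y) (δ (p x) y) (δ (q x) y)) ⟩
    ∑[ y < n ] (δ (p x) y * f y + δ (q x) y * f y)
      ≡⟨ ∑-distrib-+ (λ y → δ (p x) y * f y) (λ y → δ (q x) y * f y) ⟩
    ∑[ y < n ] (δ (p x) y * f y) + ∑[ y < n ] (δ (q x) y * f y)
      ≡⟨ cong₂ _+_ (∑-δ (p x) f) (∑-δ (q x) f) ⟩
    f (p x) + f (q x) ∎
    where open ≡-Reasoning

  degree : ∀ x → ∑[ y < n ] adjacency x y ≡ 2
  degree x = trans (∑-distrib-+ (δ (p x)) (δ (q x))) (cong₂ _+_ (∑-δ-const (p x)) (∑-δ-const (q x)))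

  handshake : ∀ (f : Fin n → ℕ) → ∑[ x < n ] (f (p x) + f (q x)) ≡ 2 * ∑[ y < n ] f y
  handshake f = begin
    ∑[ x < n ] (f (p x) + f (q x))
      ≡⟨ sum-cong-≗ (λ x → sym (∑-adjacency x f)) ⟩
    ∑[ x < n ] ∑[ y < n ] (adjacency x y * f y)
      ≡⟨ ∑-comm (λ x y → adjacency x y * f y) ⟩
    ∑[ y < n ] ∑[ x < n ] (adjacency x y * f y)
      ≡⟨ sum-cong-≗ (λ y → sum-cong-≗ λ x → cong (_* f y) (adjacency-sym x y)) ⟩
    ∑[ y < n ] ∑[ x < n ] (adjacency y x * f y)
      ≡⟨ sum-cong-≗ (λ y → sym (*-distribʳ-sum (f y) (adjacency y))) ⟩
    ∑[ y < n ] (∑[ x < n ] adjacency y x * f y)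
      ≡⟨ sum-cong-≗ (λ y → cong (_* f y) (degree y)) ⟩
    ∑[ y < n ] (2 * f y)
      ≡⟨ *-distribˡ-sum 2 f ⟨
    2 * ∑[ y < n ] f y ∎
    where open ≡-Reasoning

  split-indicator : (h : Fin n → Bool) (w : Fin n) →
    (∀ x → x ≢ w → h (p x) ≡ h (q x)) → h (p w) ≢ h (q w) →
    ∀ x → bit (h (p x) xor h (q x)) ≡ δ w x
  split-indicator h w mono split x with w ≟ x
  ... | yes refl = cong bit (xor-≢ split)
  ... | no w≢x  = cong bit (trans (cong (h (p x) xor_) (sym (mono x (w≢x ∘ sym)))) (xor-same (h (p x))))

  neighbours-monochromatic : (h : Fin n → Bool) (w : Fin n) →
    (∀ x → x ≢ w → h (p x) ≡ h (q x)) → h (p w) ≡ h (q w)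
  neighbours-monochromatic h w mono = decidable-stable (h (p w) ≟ᵇ h (q w)) λ split →
    even≢odd (∑[ y < n ] bit (h y)) (∑[ x < n ] bit (h (p x) ∧ h (q x))) (begin
      2 * ∑[ y < n ] bit (h y)
        ≡⟨ handshake (bit ∘ h) ⟨
      ∑[ x < n ] (bit (h (p x)) + bit (h (q x)))
        ≡⟨ sum-cong-≗ (λ x → bit-+ (h (p x)) (h (q x))) ⟩
      ∑[ x < n ] (2 * bit (h (p x) ∧ h (q x)) + bit (h (p x) xor h (q x)))
        ≡⟨ ∑-distrib-+ (λ x → 2 * bit (h (p x) ∧ h (q x))) (λ x → bit (h (p x) xor h (q x))) ⟩
      ∑[ x < n ] (2 * bit (h (p x) ∧ h (q x))) + ∑[ x < n ] bit (h (p x) xor h (q x))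
        ≡⟨ cong₂ _+_ (sym (*-distribˡ-sum 2 (λ x → bit (h (p x) ∧ h (q x)))))
                     (trans (sum-cong-≗ (split-indicator h w mono split)) (∑-δ-const w)) ⟩
      2 * ∑[ x < n ] bit (h (p x) ∧ h (q x)) + 1
        ≡⟨ +-comm _ 1 ⟩
      suc (2 * ∑[ x < n ] bit (h (p x) ∧ h (q x))) ∎)
    where open ≡-Reasoning

module _ {n : ℕ} (D : Digraph n) where

  Agrees : Fin n → Fin n → Fin n → Set
  Agrees x a b = (adj D a x ≡ adj D b x) × (adj D x a ≡ adj D x b)

  distinguishes? : ∀ x a b → Dec (Distinguishes D x a b)
  distinguishes? x a b = ¬? (adj D a x ≟ᵇ adj D b x) ⊎-dec ¬? (adj D x a ≟ᵇ adj D x b)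

  agrees⇒¬distinguishes : ∀ {x a b} → Agrees x a b → ¬ Distinguishes D x a b
  agrees⇒¬distinguishes (in≡ , _)  (inj₁ in≢)  = in≢ in≡
  agrees⇒¬distinguishes (_ , out≡) (inj₂ out≢) = out≢ out≡

  ¬distinguishes⇒agrees : ∀ {x a b} → ¬ Distinguishes D x a b → Agrees x a b
  ¬distinguishes⇒agrees {x} {a} {b} ¬dist =
    decidable-stable (adj D a x ≟ᵇ adj D b x) (¬dist ∘ inj₁) ,
    decidable-stable (adj D x a ≟ᵇ adj D x b) (¬dist ∘ inj₂)

  distinguishes-transfer : ∀ {a b c d} → Agrees c a b → Agrees d a b →
    Distinguishes D a c d → Distinguishes D b c d
  distinguishes-transfer (_ , c→a≡c→b) (_ , d→a≡d→b) (inj₁ ne) =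
    inj₁ λ e → ne (trans c→a≡c→b (trans e (sym d→a≡d→b)))
  distinguishes-transfer (a→c≡b→c , _) (a→d≡b→d , _) (inj₂ ne) =
    inj₂ λ e → ne (trans a→c≡b→c (trans e (sym a→d≡b→d)))

  agrees-at-left : ∀ {a b} → adj D a b ≡ false → adj D b a ≡ false → Agrees a a b
  agrees-at-left {a} ab ba = trans (loopless D a) (sym ba) , trans (loopless D a) (sym ab)

  agrees-at-right : ∀ {a b} → adj D a b ≡ false → adj D b a ≡ false → Agrees b a b
  agrees-at-right {b = b} ab ba = trans ab (sym (loopless D b)) , trans ba (sym (loopless D b))

  -- The false twins of D - v, as vertices of D.  Agreement at x = a and x = b
  -- encodes (by looplessness) that a and b are non-adjacent.
  record FalseTwinsWithout (v a b : Fin n) : Set where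
    field
      a≢b : a ≢ b
      a≢v : a ≢ v
      b≢v : b ≢ v
      agrees : ∀ x → x ≢ v → Agrees x a b

    a↛b : adj D a b ≡ false
    a↛b = trans (sym (proj₂ (agrees a a≢v))) (loopless D a)

    b↛a : adj D b a ≡ false
    b↛a = trans (sym (proj₁ (agrees a a≢v))) (loopless D a)

  FalseTwinsWithout-sym : ∀ {v a b} → FalseTwinsWithout v a b → FalseTwinsWithout v b a
  FalseTwinsWithout-sym t = record
    { a≢b = a≢b ∘ sym ; a≢v = b≢v ; b≢v = a≢v
    ; agrees = λ x x≢v → sym (proj₁ (agrees x x≢v)) , sym (proj₂ (agrees x x≢v)) }
    where open FalseTwinsWithout t

  distinguishes-deleted : PointDetermining D → ∀ {v a b} →
    FalseTwinsWithout v a b → Distinguishes D v a b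
  distinguishes-deleted pd {v} {a} {b} t = decidable-stable (distinguishes? v a b) λ ¬dist →
    pd a b ((a≢b , λ w _ _ → undistinguished w ¬dist) , a↛b , b↛a)
    where
    open FalseTwinsWithout t
    undistinguished : ∀ w → ¬ Distinguishes D v a b → ¬ Distinguishes D w a b
    undistinguished w ¬dist with w ≟ v
    ... | yes refl = ¬dist
    ... | no w≢v   = agrees⇒¬distinguishes (agrees w w≢v)

  deleted-vertex-among-twins : PointDetermining D → ∀ {v a b c d} →
    FalseTwinsWithout v a b → FalseTwinsWithout a c d → v ≡ c ⊎ v ≡ d
  deleted-vertex-among-twins pd {v} {a} {b} {c} {d} t s with v ≟ c | v ≟ d
  ... | yes v≡c | _       = inj₁ v≡c
  ... | no _    | yes v≡d = inj₂ v≡d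
  ... | no v≢c  | no v≢d  = contradiction
    (distinguishes-transfer (T.agrees c (v≢c ∘ sym)) (T.agrees d (v≢d ∘ sym)) (distinguishes-deleted pd s))
    (agrees⇒¬distinguishes (S.agrees b (T.a≢b ∘ sym)))
    where
    module T = FalseTwinsWithout t
    module S = FalseTwinsWithout s

falseTwins? : ∀ {n} (D : Digraph n) u u' → Dec (FalseTwins D u u')
falseTwins? D u u' =
  (¬? (u ≟ u') ×-dec all? (λ w → ¬? (w ≟ u) →-dec ¬? (w ≟ u') →-dec ¬? (distinguishes? D w u u')))
  ×-dec (adj D u u' ≟ᵇ false ×-dec adj D u' u ≟ᵇ false)

HasFalseTwins : ∀ {n} → Digraph n → Set
HasFalseTwins D = ∃₂ (FalseTwins D)

hasFalseTwins? : ∀ {n} (D : Digraph n) → Dec (HasFalseTwins D)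
hasFalseTwins? D = any? λ u → any? λ u' → falseTwins? D u u'

falseTwins-delete : ∀ {n} (D : Digraph (suc n)) v {u u'} →
  FalseTwins (delete D v) u u' → FalseTwinsWithout D v (punchIn v u) (punchIn v u')
falseTwins-delete D v {u} {u'} ((u≢u' , twins) , u↛u' , u'↛u) = record
  { a≢b = u≢u' ∘ punchIn-injective v u u'
  ; a≢v = punchInᵢ≢i v u
  ; b≢v = punchInᵢ≢i v u'
  ; agrees = λ x x≢v → subst (λ y → Agrees D y (punchIn v u) (punchIn v u'))
                             (punchIn-punchOut (x≢v ∘ sym)) (agreesAt (punchOut (x≢v ∘ sym)))
  }
  where
  agreesAt : ∀ x → Agrees D (punchIn v x) (punchIn v u) (punchIn v u')
  agreesAt x with x ≟ u | x ≟ u'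
  ... | yes refl | _        = agrees-at-left D u↛u' u'↛u
  ... | no _     | yes refl = agrees-at-right D u↛u' u'↛u
  ... | no x≢u   | no x≢u'  = ¬distinguishes⇒agrees D (twins x x≢u x≢u')

¬every-deletion-has-twins : ∀ {n} (D : Digraph (suc n)) → PointDetermining D →
  ¬ (∀ v → HasFalseTwins (delete D v))
¬every-deletion-has-twins {n} D pd twins = Sum.[
    (λ in≢  → in≢  (neighbours-monochromatic (λ y → adj D y zero) zero (λ x x≢0 → proj₁ (agreesAt x x≢0)))) ,
    (λ out≢ → out≢ (neighbours-monochromatic (λ y → adj D zero y) zero (λ x x≢0 → proj₂ (agreesAt x x≢0)))) ]
  (distinguishes-deleted D pd (twinsOf zero))
  where
  p q : Fin (suc n) → Fin (suc n)
  p v = punchIn v (proj₁ (twins v))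
  q v = punchIn v (proj₁ (proj₂ (twins v)))

  twinsOf : ∀ v → FalseTwinsWithout D v (p v) (q v)
  twinsOf v = falseTwins-delete D v (proj₂ (proj₂ (twins v)))

  agreesAt : ∀ x → x ≢ zero → Agrees D zero (p x) (q x)
  agreesAt x x≢0 = FalseTwinsWithout.agrees (twinsOf x) zero (x≢0 ∘ sym)

  symmetric : ∀ {x y} → p x ≡ y ⊎ q x ≡ y → p y ≡ x ⊎ q y ≡ x
  symmetric {x} (inj₁ refl) = Sum.map sym sym (deleted-vertex-among-twins D pd (twinsOf x) (twinsOf (p x)))
  symmetric {x} (inj₂ refl) = Sum.map sym sym
    (deleted-vertex-among-twins D pd (FalseTwinsWithout-sym D (twinsOf x)) (twinsOf (q x)))

  open TwoRegular p q (FalseTwinsWithout.a≢b ∘ twinsOf) symmetric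

theorem1 : (n : ℕ) (D : Digraph (suc n)) → PointDetermining D →
    Σ (Fin (suc n)) (λ v → PointDetermining (delete D v))
theorem1 n D pd =
  let v , noTwins = ¬∀⟶∃¬ (suc n) (HasFalseTwins ∘ delete D) (hasFalseTwins? ∘ delete D)
                      (¬every-deletion-has-twins D pd)
  in v , λ u u' twins → noTwins (u , u' , twins)
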